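{- Let $m$ and $n$ be non-negative integers and $r$ any integer. Then \[ \sum_{k = 1}^n k^m w_{k + r} = \mathcal P_1 (m,n;p,q)w_{n + r} + \mathcal P_2 (m,n;p,q)w_{n + r + 1} + \mathcal C(m,r;a,b,p,q), \] where $\mathcal P_1,\mathcal P_2,\mathcal C$ are defined recursively (for all non-negative integers $m$) by \[ (q - p + 1)\mathcal P_1 (m,n;p,q) = (n + 2)^m q - \sum_{j = 0}^{m - 1} \binom mj(2^{m - j} q - p)\mathcal P_1 (j,n;p,q), \] \[ (q - p + 1)\mathcal P_2 (m,n;p,q) = -(n + 1)^m - \sum_{j = 0}^{m - 1} \binom mj(2^{m - j} q - p)\mathcal P_2 (j,n;p,q), \] \[ (q - p + 1)\mathcal C (m,r;a,b,p,q) = -2^mqw_r + w_{r+1} - \sum_{j = 0}^{m - 1} \binom mj(2^{m - j} q - p)\mathcal C (j,r;a,b,p,q). \]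
   Context: Let $a,b,p,q$ be complex numbers with $p\ne0$, $q\ne0$ and $p\ne q+1$. The Horadam sequence $(w_j)=(w_j(a,b;p,q))$ is defined by $w_0=a$, $w_1=b$, $w_j=pw_{j-1}-qw_{j-2}$ for $j\ge2$, and extended to negative indices by $w_{ -j}=(pw_{ -j+1}-w_{ -j+2})/q$. Empty sums are $0$ and $0^0=1$. -}

module Defs where

open import Level using (Level)
open import Algebra.Bundles using (CommutativeRing)
open import Data.Nat using (ℕ; zero; suc)
import Data.Nat as ℕ
open import Data.Nat.Combinatorics using (_C_)
open import Data.Integer using (ℤ; +_; -[1+_])
open import Data.Fin using (Fin; toℕ)
open import Data.Vec using (Vec; []; _∷ʳ_; lookup)
open import Data.Product using (_×_; _,_; proj₁; proj₂)

module Horadam {c ℓ : Level} (R : CommutativeRing c ℓ) where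
  open CommutativeRing R

  fromℕ : ℕ → Carrier
  fromℕ zero    = 0#
  fromℕ (suc n) = 1# + fromℕ n

  infixr 8 _^_
  _^_ : Carrier → ℕ → Carrier
  x ^ zero  = 1#
  x ^ suc n = x * (x ^ n)

  sum1 : ℕ → (ℕ → Carrier) → Carrier
  sum1 zero    f = 0#
  sum1 (suc n) f = sum1 n f + f (suc n)

  sumFin : (m : ℕ) → (Fin m → Carrier) → Carrier
  sumFin zero    f = 0#
  sumFin (suc m) f = sumFin m (λ j → f (Data.Fin.inject₁ j)) + f (Data.Fin.fromℕ m)

  -- course-of-values recursion: value m = step m (values at 0..m-1)
  history : ((m : ℕ) → (Fin m → Carrier) → Carrier) → (m : ℕ) → Vec Carrier m
  history step zero    = []
  history step (suc m) = history step m ∷ʳ step m (lookup (history step m))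

  cov : ((m : ℕ) → (Fin m → Carrier) → Carrier) → ℕ → Carrier
  cov step m = step m (lookup (history step m))

  -- Horadam sequence w_j(a,b;p,q); qinv is the inverse of q
  -- forward: (w_j , w_{j+1}) for j ≥ 0
  fwd : (a b p q : Carrier) → ℕ → Carrier × Carrier
  fwd a b p q zero    = a , b
  fwd a b p q (suc j) = let (x , y) = fwd a b p q j in y , (p * y - q * x)

  -- backward: (w_{-j} , w_{-j+1}) for j ≥ 0, using w_{-j} = (p w_{-j+1} - w_{-j+2}) / q
  bwd : (a b p qinv : Carrier) → ℕ → Carrier × Carrier
  bwd a b p qinv zero    = a , b
  bwd a b p qinv (suc j) = let (x , y) = bwd a b p qinv j in (p * x - y) * qinv , x

  w : (a b p q qinv : Carrier) → ℤ → Carrier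
  w a b p q qinv (+ j)      = proj₁ (fwd a b p q j)
  w a b p q qinv -[1+ j ]   = proj₁ (bwd a b p qinv (suc j))

  coef : (p q : Carrier) (m : ℕ) → Fin m → Carrier
  coef p q m j = fromℕ (m C toℕ j) * (fromℕ 2 ^ (m ℕ.∸ toℕ j) * q - p)

  -- dinv is the inverse of (q - p + 1)
  P₁ : (p q dinv : Carrier) (n : ℕ) → ℕ → Carrier
  P₁ p q dinv n = cov (λ m prev →
    dinv * (fromℕ (n ℕ.+ 2) ^ m * q - sumFin m (λ j → coef p q m j * prev j)))

  P₂ : (p q dinv : Carrier) (n : ℕ) → ℕ → Carrier
  P₂ p q dinv n = cov (λ m prev →
    dinv * (- (fromℕ (n ℕ.+ 1) ^ m) - sumFin m (λ j → coef p q m j * prev j)))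

  𝒞 : (a b p q qinv dinv : Carrier) (r : ℤ) → ℕ → Carrier
  𝒞 a b p q qinv dinv r = cov (λ m prev →
    dinv * (- (fromℕ 2 ^ m * q * w a b p q qinv r) + w a b p q qinv (r Data.Integer.+ + 1)
            - sumFin m (λ j → coef p q m j * prev j)))

{-# OPTIONS --safe #-}
module Submission where

-- Put u k = w (k + r), d = q - p + 1 and T m = Σ_{k=1}^n k^m u k.  For each m the sums
-- T 0, …, T m satisfy the lower-triangular relation
--   d T m + Σ_{j<m} binom(m,j) (2^{m-j} q - p) T j
--     = (n+2)^m q u n - (n+1)^m u (n+1) - 2^m q u 0 + u 1,
-- by induction on n: by the binomial theorem the summand n^m u n added in passing from n - 1
-- to n contributes ((n+2)^m q - (n+1)^m p + n^m) u n to the left side, and the recurrence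
-- u (n+2) = p u (n+1) - q u n turns this into the change of the right side.  The recursions
-- defining P₁, P₂ and 𝒞 say that P₁ u n + P₂ u (n+1) + 𝒞 satisfies the same system, whose
-- solution is unique because d is invertible.

open import Level using (Level)
open import Algebra.Bundles using (CommutativeRing)
import Algebra.Properties.CommutativeSemigroup as CommutativeSemigroupProperties
import Algebra.Solver.Ring.AlmostCommutativeRing as ACR
open import Data.Nat using (ℕ; zero; suc)
import Data.Nat as ℕ
import Data.Nat.Properties as ℕₚ
open import Data.Nat.Induction using (<-rec)
open import Data.Nat.Combinatorics using (_C_; nCn≡1)
open import Data.Integer using (ℤ; +_; -[1+_]; _⊖_; ∣_∣; sign; _◃_)
import Data.Integer as ℤ
import Data.Integer.Properties as ℤₚ
open import Data.Sign using (Sign)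
import Data.Sign as Sign
open import Data.Fin using (Fin; toℕ; inject₁)
import Data.Fin as Fin
open import Data.Fin.Properties using (toℕ-inject₁; toℕ-fromℕ; toℕ<n)
open import Data.Fin.Relation.Unary.Top using (view; ‵fromℕ; ‵inject₁)
open import Data.Vec using (Vec; []; _∷_; _∷ʳ_; lookup)
open import Data.Maybe using (Maybe; just; nothing)
open import Relation.Nullary using (¬_; yes; no)
open import Relation.Binary.PropositionalEquality as ≡ using (_≡_)
open import Defs

lookup-∷ʳ-inject₁ : ∀ {a} {A : Set a} {n} (xs : Vec A n) x (i : Fin n) →
                    lookup (xs ∷ʳ x) (inject₁ i) ≡ lookup xs i
lookup-∷ʳ-inject₁ (y ∷ ys) x Fin.zero    = ≡.refl
lookup-∷ʳ-inject₁ (y ∷ ys) x (Fin.suc i) = lookup-∷ʳ-inject₁ ys x i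

lookup-∷ʳ-last : ∀ {a} {A : Set a} {n} (xs : Vec A n) x → lookup (xs ∷ʳ x) (Fin.fromℕ n) ≡ x
lookup-∷ʳ-last []       x = ≡.refl
lookup-∷ʳ-last (y ∷ ys) x = lookup-∷ʳ-last ys x

+-shift : ∀ k t r → + (t ℕ.+ k) ℤ.+ r ≡ (+ k ℤ.+ r) ℤ.+ + t
+-shift k t r = ≡.trans (≡.cong (ℤ._+ r) (ℤₚ.pos-+ t k)) (xy∙z≈yz∙x (+ t) (+ k) r)
  where open CommutativeSemigroupProperties ℤₚ.+-commutativeSemigroup using (xy∙z≈yz∙x)

-- The ring solver needs coefficients whose arithmetic computes; integers mapped into R provide them.
module IntegerCoefficients {c ℓ} (R : CommutativeRing c ℓ) where
  open CommutativeRing R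
  open import Algebra.Properties.Ring ring
    using (-0#≈0#; -‿involutive; -‿+-comm; -‿distribˡ-*; -‿distribʳ-*)
  open import Algebra.Properties.Semiring.Mult.TCOptimised semiring using (_×_; ×-homo-+; ×1-homo-*)
  open CommutativeSemigroupProperties +-commutativeSemigroup using (interchange)
  open import Relation.Binary.Reasoning.Setoid setoid

  signed : Sign → Carrier → Carrier
  signed Sign.+ x = x
  signed Sign.- x = - x

  signed-cong : ∀ s {x y} → x ≈ y → signed s x ≈ signed s y
  signed-cong Sign.+ x≈y = x≈y
  signed-cong Sign.- x≈y = -‿cong x≈y

  signed-* : ∀ s t x y → signed (s Sign.* t) (x * y) ≈ signed s x * signed t y
  signed-* Sign.+ Sign.+ x y = refl
  signed-* Sign.+ Sign.- x y = -‿distribʳ-* x y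
  signed-* Sign.- Sign.+ x y = -‿distribˡ-* x y
  signed-* Sign.- Sign.- x y = begin
    x * y           ≈⟨ -‿involutive _ ⟨
    - - (x * y)     ≈⟨ -‿cong (-‿distribʳ-* x y) ⟩
    - (x * - y)     ≈⟨ -‿distribˡ-* x (- y) ⟩
    - x * - y       ∎

  fromℤ : ℤ → Carrier
  fromℤ i = signed (sign i) (∣ i ∣ × 1#)

  fromℤ-◃ : ∀ s n → fromℤ (s ◃ n) ≈ signed s (n × 1#)
  fromℤ-◃ Sign.+ zero    = refl
  fromℤ-◃ Sign.- zero    = sym -0#≈0#
  fromℤ-◃ Sign.+ (suc n) = refl
  fromℤ-◃ Sign.- (suc n) = refl

  fromℤ-* : ∀ i j → fromℤ (i ℤ.* j) ≈ fromℤ i * fromℤ j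
  fromℤ-* i j = begin
    fromℤ ((sign i Sign.* sign j) ◃ (∣ i ∣ ℕ.* ∣ j ∣))
      ≈⟨ fromℤ-◃ (sign i Sign.* sign j) (∣ i ∣ ℕ.* ∣ j ∣) ⟩
    signed (sign i Sign.* sign j) ((∣ i ∣ ℕ.* ∣ j ∣) × 1#)
      ≈⟨ signed-cong (sign i Sign.* sign j) (×1-homo-* ∣ i ∣ ∣ j ∣) ⟩
    signed (sign i Sign.* sign j) ((∣ i ∣ × 1#) * (∣ j ∣ × 1#))
      ≈⟨ signed-* (sign i) (sign j) _ _ ⟩
    fromℤ i * fromℤ j ∎

  fromℤ-⊖ : ∀ m n → fromℤ (m ⊖ n) ≈ m × 1# - n × 1#
  fromℤ-⊖ m zero = begin
    fromℤ (m ⊖ 0)    ≡⟨ ≡.cong fromℤ (ℤₚ.⊖-≥ {m} ℕ.z≤n) ⟩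
    m × 1#           ≈⟨ +-identityʳ _ ⟨
    m × 1# + 0#      ≈⟨ +-congˡ -0#≈0# ⟨
    m × 1# - 0#      ∎
  fromℤ-⊖ zero (suc n) = begin
    fromℤ (0 ⊖ suc n)    ≡⟨ ≡.cong fromℤ (ℤₚ.⊖-< {0} {suc n} (ℕ.s≤s ℕ.z≤n)) ⟩
    - (suc n × 1#)       ≈⟨ +-identityˡ _ ⟨
    0# - suc n × 1#      ∎
  fromℤ-⊖ (suc m) (suc n) = begin
    fromℤ (suc m ⊖ suc n)                   ≡⟨ ≡.cong fromℤ (ℤₚ.[1+m]⊖[1+n]≡m⊖n m n) ⟩
    fromℤ (m ⊖ n)                           ≈⟨ fromℤ-⊖ m n ⟩
    m × 1# - n × 1#                         ≈⟨ +-identityˡ _ ⟨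
    0# + (m × 1# - n × 1#)                  ≈⟨ +-congʳ (-‿inverseʳ 1#) ⟨
    (1# - 1#) + (m × 1# - n × 1#)           ≈⟨ interchange 1# (- 1#) (m × 1#) (- (n × 1#)) ⟩
    (1# + m × 1#) + (- 1# - n × 1#)         ≈⟨ +-congˡ (-‿+-comm 1# (n × 1#)) ⟩
    (1# + m × 1#) - (1# + n × 1#)           ≈⟨ +-cong (×-homo-+ 1# 1 m) (-‿cong (×-homo-+ 1# 1 n)) ⟨
    suc m × 1# - suc n × 1#                 ∎

  fromℤ-+ : ∀ i j → fromℤ (i ℤ.+ j) ≈ fromℤ i + fromℤ j
  fromℤ-+ (+ m)    (+ n)    = ×-homo-+ 1# m n
  fromℤ-+ (+ m)    -[1+ n ] = fromℤ-⊖ m (suc n)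
  fromℤ-+ -[1+ m ] (+ n)    = trans (fromℤ-⊖ n (suc m)) (+-comm _ _)
  fromℤ-+ -[1+ m ] -[1+ n ] = begin
    - (suc (suc (m ℕ.+ n)) × 1#)          ≡⟨ ≡.cong (λ k → - (suc k × 1#)) (ℕₚ.+-suc m n) ⟨
    - ((suc m ℕ.+ suc n) × 1#)            ≈⟨ -‿cong (×-homo-+ 1# (suc m) (suc n)) ⟩
    - (suc m × 1# + suc n × 1#)           ≈⟨ -‿+-comm _ _ ⟨
    - (suc m × 1#) - suc n × 1#           ∎

  fromℤ-neg : ∀ i → fromℤ (ℤ.- i) ≈ - fromℤ i
  fromℤ-neg (+ zero)  = sym -0#≈0#
  fromℤ-neg (+ suc n) = refl
  fromℤ-neg -[1+ n ]  = sym (-‿involutive _)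

  fromℤ-homomorphism : ACR._-Raw-AlmostCommutative⟶_ ℤ.+-*-rawRing (ACR.fromCommutativeRing R)
  fromℤ-homomorphism = record
    { ⟦_⟧    = fromℤ
    ; +-homo = fromℤ-+
    ; *-homo = fromℤ-*
    ; -‿homo = fromℤ-neg
    ; 0-homo = refl
    ; 1-homo = refl
    }

  fromℤ-≟ : ∀ i j → Maybe (fromℤ i ≈ fromℤ j)
  fromℤ-≟ i j with i ℤ.≟ j
  ... | yes ≡.refl = just refl
  ... | no _       = nothing

  open import Algebra.Solver.Ring ℤ.+-*-rawRing (ACR.fromCommutativeRing R) fromℤ-homomorphism fromℤ-≟ public

module _ {c ℓ} (R : CommutativeRing c ℓ) where
  open CommutativeRing R
  open Horadam R
  open IntegerCoefficients R using (solve; _:=_; _:+_; _:-_; _:*_; con)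
  open CommutativeSemigroupProperties +-commutativeSemigroup using (interchange)
  import Algebra.Properties.CommutativeSemiring.Binomial commutativeSemiring as Binomial
  open import Algebra.Properties.Semiring.Sum semiring using (sum; sum-init-last)
  import Algebra.Properties.Semiring.Exp semiring as Exp
  import Algebra.Properties.Semiring.Mult semiring as Mult
  open import Relation.Binary.Reasoning.Setoid setoid

  sumFin-cong : ∀ m {f g : Fin m → Carrier} → (∀ j → f j ≈ g j) → sumFin m f ≈ sumFin m g
  sumFin-cong zero    f≈g = refl
  sumFin-cong (suc m) f≈g = +-cong (sumFin-cong m (λ j → f≈g (inject₁ j))) (f≈g (Fin.fromℕ m))

  sumFin-distrib-+ : ∀ m (f g : Fin m → Carrier) →
                     sumFin m (λ j → f j + g j) ≈ sumFin m f + sumFin m g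
  sumFin-distrib-+ zero    f g = sym (+-identityˡ 0#)
  sumFin-distrib-+ (suc m) f g =
    trans (+-congʳ (sumFin-distrib-+ m _ _)) (interchange _ _ _ _)

  sumFin-distrib-- : ∀ m (f g : Fin m → Carrier) →
                     sumFin m (λ j → f j - g j) ≈ sumFin m f - sumFin m g
  sumFin-distrib-- zero    f g = solve 0 (con (+ 0) := con (+ 0) :- con (+ 0)) refl
  sumFin-distrib-- (suc m) f g = trans (+-congʳ (sumFin-distrib-- m _ _))
    (solve 4 (λ s t x y → (s :- t) :+ (x :- y) := (s :+ x) :- (t :+ y)) refl _ _ _ _)

  sumFin-distribʳ : ∀ m (f : Fin m → Carrier) x → sumFin m (λ j → f j * x) ≈ sumFin m f * x
  sumFin-distribʳ zero    f x = sym (zeroˡ x)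
  sumFin-distribʳ (suc m) f x = trans (+-congʳ (sumFin-distribʳ m _ x)) (sym (distribʳ x _ _))

  fromℕ-+ : ∀ m n → fromℕ (m ℕ.+ n) ≈ fromℕ m + fromℕ n
  fromℕ-+ zero    n = sym (+-identityˡ _)
  fromℕ-+ (suc m) n = trans (+-congˡ (fromℕ-+ m n)) (sym (+-assoc _ _ _))

  ^-cong : ∀ {x y} k → x ≈ y → x ^ k ≈ y ^ k
  ^-cong zero    x≈y = refl
  ^-cong (suc k) x≈y = *-cong x≈y (^-cong k x≈y)

  1^≈1 : ∀ k → fromℕ 1 ^ k ≈ 1#
  1^≈1 zero    = refl
  1^≈1 (suc k) = trans (*-cong (+-identityʳ 1#) (1^≈1 k)) (*-identityˡ 1#)

  ^≈Exp^ : ∀ x k → x ^ k ≈ x Exp.^ k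
  ^≈Exp^ x zero    = refl
  ^≈Exp^ x (suc k) = *-congˡ (^≈Exp^ x k)

  fromℕ*≈× : ∀ k x → fromℕ k * x ≈ k Mult.× x
  fromℕ*≈× zero    x = zeroˡ x
  fromℕ*≈× (suc k) x = trans (distribʳ x 1# (fromℕ k)) (+-cong (*-identityˡ x) (fromℕ*≈× k x))

  sum≈sumFin : ∀ m (f : Fin m → Carrier) → sum f ≈ sumFin m f
  sum≈sumFin zero    f = refl
  sum≈sumFin (suc m) f = trans (sum-init-last f) (+-congʳ (sum≈sumFin m _))

  binomial : ∀ x y m →
    (x + y) ^ m ≈ sumFin m (λ j → fromℕ (m C toℕ j) * (y ^ (m ℕ.∸ toℕ j) * x ^ toℕ j)) + x ^ m
  binomial x y m = begin
    (x + y) ^ m                                      ≈⟨ ^≈Exp^ (x + y) m ⟩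
    (x + y) Exp.^ m                                  ≈⟨ Binomial.theorem m x y ⟩
    sum term                                         ≈⟨ sum≈sumFin (suc m) term ⟩
    sumFin m (λ j → term (inject₁ j)) + term (Fin.fromℕ m)
      ≈⟨ +-cong (sumFin-cong m (λ j → trans (term≈ (inject₁ j)) (reflexive (≡.cong summand (toℕ-inject₁ j)))))
                (trans (term≈ (Fin.fromℕ m)) (reflexive (≡.cong summand (toℕ-fromℕ m)))) ⟩
    sumFin m (λ j → summand (toℕ j)) + summand m     ≈⟨ +-congˡ top ⟩
    sumFin m (λ j → summand (toℕ j)) + x ^ m         ∎
    where
    summand : ℕ → Carrier
    summand k = fromℕ (m C k) * (y ^ (m ℕ.∸ k) * x ^ k)
    term : Fin (suc m) → Carrier
    term k = (m C toℕ k) Mult.× (x Exp.^ toℕ k * y Exp.^ (m ℕ.∸ toℕ k))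
    term≈ : ∀ k → term k ≈ summand (toℕ k)
    term≈ k = sym (trans (*-congˡ (trans (*-comm _ _) (*-cong (^≈Exp^ x (toℕ k)) (^≈Exp^ y (m ℕ.∸ toℕ k)))))
                         (fromℕ*≈× (m C toℕ k) _))
    top : summand m ≈ x ^ m
    top = begin
      fromℕ (m C m) * (y ^ (m ℕ.∸ m) * x ^ m)   ≡⟨ ≡.cong₂ (λ i k → fromℕ i * (y ^ k * x ^ m)) (nCn≡1 m) (ℕₚ.n∸n≡0 m) ⟩
      fromℕ 1 * (1# * x ^ m)                     ≈⟨ trans (*-cong (+-identityʳ 1#) (*-identityˡ _)) (*-identityˡ _) ⟩
      x ^ m                                      ∎

  lookup-history : ∀ step m (j : Fin m) → lookup (history step m) j ≡ cov step (toℕ j)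
  lookup-history step (suc m) j with view j
  ... | ‵fromℕ = ≡.trans (lookup-∷ʳ-last (history step m) _) (≡.cong (cov step) (≡.sym (toℕ-fromℕ m)))
  ... | ‵inject₁ i = ≡.trans (lookup-∷ʳ-inject₁ (history step m) _ i)
                       (≡.trans (lookup-history step m i) (≡.cong (cov step) (≡.sym (toℕ-inject₁ i))))

  module TriangularSystem (d : Carrier) (α : (m : ℕ) → Fin m → Carrier) where

    Solves : (ℕ → Carrier) → (ℕ → Carrier) → Set ℓ
    Solves g y = ∀ m → d * y m + sumFin m (λ j → α m j * y (toℕ j)) ≈ g m

    solves-resp : ∀ {g h y} → (∀ m → g m ≈ h m) → Solves g y → Solves h y
    solves-resp g≈h sol m = trans (sol m) (g≈h m)

    solves-zero : Solves (λ _ → 0#) (λ _ → 0#)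
    solves-zero m = begin
      d * 0# + sumFin m (λ j → α m j * 0#)   ≈⟨ +-congˡ (sumFin-distribʳ m (α m) 0#) ⟩
      d * 0# + sumFin m (α m) * 0#           ≈⟨ +-cong (zeroʳ d) (zeroʳ _) ⟩
      0# + 0#                                ≈⟨ +-identityʳ 0# ⟩
      0#                                     ∎

    solves-+ : ∀ {g h y z} → Solves g y → Solves h z → Solves (λ m → g m + h m) (λ m → y m + z m)
    solves-+ {y = y} {z} sol-y sol-z m = begin
      d * (y m + z m) + sumFin m (λ j → α m j * (y (toℕ j) + z (toℕ j)))
        ≈⟨ +-cong (distribˡ d _ _) (trans (sumFin-cong m (λ j → distribˡ (α m j) _ _)) (sumFin-distrib-+ m _ _)) ⟩
      (d * y m + d * z m) + (sumFin m (λ j → α m j * y (toℕ j)) + sumFin m (λ j → α m j * z (toℕ j)))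
        ≈⟨ interchange _ _ _ _ ⟩
      (d * y m + sumFin m (λ j → α m j * y (toℕ j))) + (d * z m + sumFin m (λ j → α m j * z (toℕ j)))
        ≈⟨ +-cong (sol-y m) (sol-z m) ⟩
      _ ∎

    solves-*ʳ : ∀ {g y} x → Solves g y → Solves (λ m → g m * x) (λ m → y m * x)
    solves-*ʳ {y = y} x sol m = begin
      d * (y m * x) + sumFin m (λ j → α m j * (y (toℕ j) * x))
        ≈⟨ +-cong (sym (*-assoc d _ x)) (trans (sumFin-cong m (λ j → sym (*-assoc (α m j) _ x))) (sumFin-distribʳ m _ x)) ⟩
      d * y m * x + sumFin m (λ j → α m j * y (toℕ j)) * x
        ≈⟨ distribʳ x _ _ ⟨
      (d * y m + sumFin m (λ j → α m j * y (toℕ j))) * x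
        ≈⟨ *-congʳ (sol m) ⟩
      _ ∎

    Solution : Carrier → (ℕ → Carrier) → ℕ → Carrier
    Solution d⁻¹ g = cov (λ m prev → d⁻¹ * (g m - sumFin m (λ j → α m j * prev j)))

    module _ {d⁻¹ : Carrier} (d*d⁻¹≈1 : d * d⁻¹ ≈ 1#) where

      isolate : ∀ {y s g} → d * y + s ≈ g → y ≈ d⁻¹ * (g - s)
      isolate {y} {s} {g} dy+s≈g = begin
        y                         ≈⟨ *-identityˡ y ⟨
        1# * y                    ≈⟨ *-congʳ (trans (*-comm d⁻¹ d) d*d⁻¹≈1) ⟨
        d⁻¹ * d * y               ≈⟨ solve 4 (λ e d y s → e :* d :* y := e :* ((d :* y :+ s) :- s)) refl d⁻¹ d y s ⟩
        d⁻¹ * ((d * y + s) - s)   ≈⟨ *-congˡ (+-congʳ dy+s≈g) ⟩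
        d⁻¹ * (g - s)             ∎

      solution-solves : ∀ g → Solves g (Solution d⁻¹ g)
      solution-solves g m = begin
        d * (d⁻¹ * (g m - S′)) + S   ≈⟨ +-congʳ (*-congˡ (*-congˡ (+-congˡ (-‿cong S′≈S)))) ⟩
        d * (d⁻¹ * (g m - S)) + S    ≈⟨ +-congʳ (*-assoc d d⁻¹ _) ⟨
        d * d⁻¹ * (g m - S) + S      ≈⟨ +-congʳ (trans (*-congʳ d*d⁻¹≈1) (*-identityˡ _)) ⟩
        g m - S + S                  ≈⟨ solve 2 (λ g s → g :- s :+ s := g) refl (g m) S ⟩
        g m                          ∎
        where
        step = λ m prev → d⁻¹ * (g m - sumFin m (λ j → α m j * prev j))
        S′ = sumFin m (λ j → α m j * lookup (history step m) j)
        S  = sumFin m (λ j → α m j * Solution d⁻¹ g (toℕ j))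
        S′≈S : S′ ≈ S
        S′≈S = sumFin-cong m (λ j → *-congˡ (reflexive (lookup-history step m j)))

      solves-unique : ∀ {g y z} → Solves g y → Solves g z → ∀ m → y m ≈ z m
      solves-unique {g} {y} {z} sol-y sol-z = <-rec _ λ m y≈z-below → begin
        y m                                                 ≈⟨ isolate (sol-y m) ⟩
        d⁻¹ * (g m - sumFin m (λ j → α m j * y (toℕ j)))
          ≈⟨ *-congˡ (+-congˡ (-‿cong (sumFin-cong m (λ j → *-congˡ (y≈z-below (toℕ<n j)))))) ⟩
        d⁻¹ * (g m - sumFin m (λ j → α m j * z (toℕ j)))    ≈⟨ isolate (sol-z m) ⟨
        z m                                                 ∎

  module BinomialSystem (p q : Carrier) where
    open TriangularSystem (q - p + 1#) (coef p q) public

    powers-solve : ∀ x → Solves (λ m → (x + fromℕ 2) ^ m * q - (x + fromℕ 1) ^ m * p + x ^ m) (x ^_)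
    powers-solve x m = begin
      (q - p + 1#) * X + sumFin m (λ j → coef p q m j * x ^ toℕ j)
        ≈⟨ +-congˡ (trans (sumFin-cong m split) (sumFin-distrib-- m _ _)) ⟩
      (q - p + 1#) * X + (sumFin m (λ j → term 2 j * q) - sumFin m (λ j → term 1 j * p))
        ≈⟨ +-congˡ (+-cong (sumFin-distribʳ m (term 2) q) (-‿cong (sumFin-distribʳ m (term 1) p))) ⟩
      (q - p + 1#) * X + (sumFin m (term 2) * q - sumFin m (term 1) * p)
        ≈⟨ solve 5 (λ q p X S₂ S₁ → (q :- p :+ con (+ 1)) :* X :+ (S₂ :* q :- S₁ :* p)
                                    := (S₂ :+ X) :* q :- (S₁ :+ X) :* p :+ X)
                 refl q p X (sumFin m (term 2)) (sumFin m (term 1)) ⟩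
      (sumFin m (term 2) + X) * q - (sumFin m (term 1) + X) * p + X
        ≈⟨ +-congʳ (+-cong (*-congʳ (binomial x (fromℕ 2) m)) (-‿cong (*-congʳ (binomial x (fromℕ 1) m)))) ⟨
      (x + fromℕ 2) ^ m * q - (x + fromℕ 1) ^ m * p + X ∎
      where
      X = x ^ m
      term : ℕ → Fin m → Carrier
      term k j = fromℕ (m C toℕ j) * (fromℕ k ^ (m ℕ.∸ toℕ j) * x ^ toℕ j)
      split : ∀ j → coef p q m j * x ^ toℕ j ≈ term 2 j * q - term 1 j * p
      split j = begin
        fromℕ (m C toℕ j) * (T * q - p) * x ^ toℕ j
          ≈⟨ *-congʳ (*-congˡ (+-congˡ (-‿cong (trans (*-congʳ (1^≈1 (m ℕ.∸ toℕ j))) (*-identityˡ p))))) ⟨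
        fromℕ (m C toℕ j) * (T * q - O * p) * x ^ toℕ j
          ≈⟨ solve 6 (λ C T O q p y → C :* (T :* q :- O :* p) :* y := C :* (T :* y) :* q :- C :* (O :* y) :* p)
                   refl _ T O q p _ ⟩
        term 2 j * q - term 1 j * p ∎
        where
        T = fromℕ 2 ^ (m ℕ.∸ toℕ j)
        O = fromℕ 1 ^ (m ℕ.∸ toℕ j)

  module LinearRecurrenceSums (p q : Carrier) (u : ℕ → Carrier)
      (u-rec : ∀ k → u (suc (suc k)) ≈ p * u (suc k) - q * u k) where
    open BinomialSystem p q public

    weightedSum : ℕ → ℕ → Carrier
    weightedSum n m = sum1 n (λ k → fromℕ k ^ m * u k)

    boundaryTerm : ℕ → ℕ → Carrier
    boundaryTerm n m =
      fromℕ (n ℕ.+ 2) ^ m * q * u n - fromℕ (n ℕ.+ 1) ^ m * u (suc n) - fromℕ 2 ^ m * q * u 0 + u 1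

    boundaryTerm-zero : ∀ m → 0# ≈ boundaryTerm 0 m
    boundaryTerm-zero m = begin
      0#                            ≈⟨ solve 2 (λ E v → con (+ 0) := E :- v :- E :+ v) refl E (u 1) ⟩
      E - u 1 - E + u 1             ≈⟨ +-congʳ (+-congʳ (+-congˡ (-‿cong (trans (*-congʳ (1^≈1 m)) (*-identityˡ _))))) ⟨
      E - fromℕ 1 ^ m * u 1 - E + u 1 ∎
      where E = fromℕ 2 ^ m * q * u 0

    boundaryTerm-step : ∀ n m →
      boundaryTerm n m + ((fromℕ (suc n) + fromℕ 2) ^ m * q - (fromℕ (suc n) + fromℕ 1) ^ m * p
                          + fromℕ (suc n) ^ m) * u (suc n)
        ≈ boundaryTerm (suc n) m
    boundaryTerm-step n m = begin
      A * q * U - B * V - E + u 1 + ((fromℕ (suc n) + fromℕ 2) ^ m * q - (fromℕ (suc n) + fromℕ 1) ^ m * p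
                                     + fromℕ (suc n) ^ m) * V
        ≈⟨ +-congˡ (*-congʳ (+-cong (+-cong (*-congʳ (^-cong m (sym (fromℕ-+ (suc n) 2))))
                                             (-‿cong (*-congʳ (^-cong m x+1≈n+2))))
                                    (reflexive (≡.cong (λ k → fromℕ k ^ m) (ℕₚ.+-comm 1 n))))) ⟩
      A * q * U - B * V - E + u 1 + (D * q - A * p + B) * V
        ≈⟨ solve 9 (λ A B D q p U V E v → A :* q :* U :- B :* V :- E :+ v :+ (D :* q :- A :* p :+ B) :* V
                                          := D :* q :* V :- A :* (p :* V :- q :* U) :- E :+ v)
                 refl A B D q p U V E (u 1) ⟩
      D * q * V - A * (p * V - q * U) - E + u 1
        ≈⟨ +-congʳ (+-congʳ (+-congˡ (-‿cong (*-cong (reflexive (≡.cong (λ k → fromℕ k ^ m) (ℕₚ.+-suc n 1)))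
                                                     (sym (u-rec n)))))) ⟩
      boundaryTerm (suc n) m ∎
      where
      A = fromℕ (n ℕ.+ 2) ^ m
      B = fromℕ (n ℕ.+ 1) ^ m
      D = fromℕ (suc n ℕ.+ 2) ^ m
      E = fromℕ 2 ^ m * q * u 0
      U = u n
      V = u (suc n)
      x+1≈n+2 : fromℕ (suc n) + fromℕ 1 ≈ fromℕ (n ℕ.+ 2)
      x+1≈n+2 = trans (sym (fromℕ-+ (suc n) 1)) (reflexive (≡.cong fromℕ (≡.sym (ℕₚ.+-suc n 1))))

    weightedSum-solves : ∀ n → Solves (boundaryTerm n) (weightedSum n)
    weightedSum-solves zero    = solves-resp boundaryTerm-zero solves-zero
    weightedSum-solves (suc n) = solves-resp (boundaryTerm-step n)
      (solves-+ (weightedSum-solves n) (solves-*ʳ (u (suc n)) (powers-solve (fromℕ (suc n)))))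

  module HoradamRecurrence (a b p q q⁻¹ : Carrier) (q*q⁻¹≈1 : q * q⁻¹ ≈ 1#) where

    W : ℤ → Carrier
    W = w a b p q q⁻¹

    backward-step : ∀ x y → y ≈ p * x - q * ((p * x - y) * q⁻¹)
    backward-step x y = begin
      y                                ≈⟨ solve 2 (λ z y → y := z :- (z :- y)) refl (p * x) y ⟩
      p * x - (p * x - y)              ≈⟨ +-congˡ (-‿cong q*[z*q⁻¹]≈z) ⟨
      p * x - q * ((p * x - y) * q⁻¹)  ∎
      where
      q*[z*q⁻¹]≈z : q * ((p * x - y) * q⁻¹) ≈ p * x - y
      q*[z*q⁻¹]≈z = trans (*-congˡ (*-comm _ q⁻¹))
                          (trans (sym (*-assoc q q⁻¹ _)) (trans (*-congʳ q*q⁻¹≈1) (*-identityˡ _)))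

    W-rec : ∀ i → W (i ℤ.+ + 2) ≈ p * W (i ℤ.+ + 1) - q * W i
    W-rec (+ j) rewrite ℕₚ.+-comm j 2 | ℕₚ.+-comm j 1 = refl
    W-rec -[1+ 0 ]             = backward-step a b
    W-rec -[1+ 1 ]             = backward-step _ a
    W-rec -[1+ suc (suc j) ]   = backward-step _ _

    shifted : ℤ → ℕ → Carrier
    shifted r k = W (+ k ℤ.+ r)

    shifted-rec : ∀ r k → shifted r (suc (suc k)) ≈ p * shifted r (suc k) - q * shifted r k
    shifted-rec r k = begin
      W (+ (2 ℕ.+ k) ℤ.+ r)                     ≡⟨ ≡.cong W (+-shift k 2 r) ⟩
      W ((+ k ℤ.+ r) ℤ.+ + 2)                   ≈⟨ W-rec (+ k ℤ.+ r) ⟩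
      p * W ((+ k ℤ.+ r) ℤ.+ + 1) - q * W (+ k ℤ.+ r)
        ≡⟨ ≡.cong (λ i → p * W i - q * W (+ k ℤ.+ r)) (+-shift k 1 r) ⟨
      p * W (+ (1 ℕ.+ k) ℤ.+ r) - q * W (+ k ℤ.+ r) ∎

mainTheorem8 : ∀ {c ℓ : Level} (R : CommutativeRing c ℓ) →
    let open CommutativeRing R
        open Horadam R
    in (a b p q qinv dinv : Carrier) →
       ¬ (p ≈ 0#) →
       q * qinv ≈ 1# →
       (q - p + 1#) * dinv ≈ 1# →
       (m n : ℕ) (r : ℤ) →
       sum1 n (λ k → fromℕ k ^ m * w a b p q qinv (+ k ℤ.+ r))
         ≈ P₁ p q dinv n m * w a b p q qinv (+ n ℤ.+ r)
           + P₂ p q dinv n m * w a b p q qinv (+ n ℤ.+ r ℤ.+ + 1)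
           + 𝒞 a b p q qinv dinv r m
mainTheorem8 R a b p q qinv dinv _ q*qinv≈1 d*dinv≈1 m n r = begin
  weightedSum n m
    ≈⟨ solves-unique d*dinv≈1 (solves-resp boundaryTerm-split (weightedSum-solves n)) expansion-solves m ⟩
  P₁ p q dinv n m * u n + P₂ p q dinv n m * u (suc n) + 𝒞 a b p q qinv dinv r m
    ≡⟨ ≡.cong (λ i → P₁ p q dinv n m * u n + P₂ p q dinv n m * W i + 𝒞 a b p q qinv dinv r m) (+-shift n 1 r) ⟩
  P₁ p q dinv n m * u n + P₂ p q dinv n m * W (+ n ℤ.+ r ℤ.+ + 1) + 𝒞 a b p q qinv dinv r m ∎
  where
  open CommutativeRing R
  open Horadam R
  open HoradamRecurrence R a b p q qinv q*qinv≈1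
  open LinearRecurrenceSums R p q (shifted r) (shifted-rec r)
  open IntegerCoefficients R using (solve; _:=_; _:+_; _:-_; _:*_; :-_)
  open import Relation.Binary.Reasoning.Setoid setoid

  u : ℕ → Carrier
  u = shifted r

  𝒞-rhs : ℕ → Carrier
  𝒞-rhs m = - (fromℕ 2 ^ m * q * W r) + W (r ℤ.+ + 1)

  rhs : ℕ → Carrier
  rhs m = fromℕ (n ℕ.+ 2) ^ m * q * u n + - (fromℕ (n ℕ.+ 1) ^ m) * u (suc n) + 𝒞-rhs m

  expansion-solves : Solves rhs (λ m → P₁ p q dinv n m * u n + P₂ p q dinv n m * u (suc n) + 𝒞 a b p q qinv dinv r m)
  expansion-solves = solves-+ (solves-+ (solves-*ʳ (u n) (solution-solves d*dinv≈1 _))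
                                        (solves-*ʳ (u (suc n)) (solution-solves d*dinv≈1 _)))
                              (solution-solves d*dinv≈1 𝒞-rhs)

  boundaryTerm-split : ∀ m → boundaryTerm n m ≈ rhs m
  boundaryTerm-split m = trans
    (+-cong (+-congˡ (-‿cong (*-congˡ (reflexive (≡.cong W (ℤₚ.+-identityˡ r))))))
            (reflexive (≡.cong W (ℤₚ.+-comm (+ 1) r))))
    (solve 7 (λ A B q U V E v → A :* q :* U :- B :* V :- E :+ v := A :* q :* U :+ (:- B) :* V :+ (:- E :+ v))
           refl (fromℕ (n ℕ.+ 2) ^ m) (fromℕ (n ℕ.+ 1) ^ m) q (u n) (u (suc n)) (fromℕ 2 ^ m * q * W r) (W (r ℤ.+ + 1)))
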